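{- Let $\lambda$ be a Young diagram with $k$ rows of lengths $\lambda_1\ge\dots\ge\lambda_k>0$, and let $T$ be an X-diagram of shape $\lambda$ whose bottom row is not a zero-row. Let $j$ be the index of the pivot column of $T$. Then for every $i<j$ the following are equivalent: (i) the top $k-1$ entries of column $i$ contain strictly fewer 0s than the top $k-1$ entries of column $j$; (ii) $T(k,i)=1$.
   Context: Young diagrams are in English notation: rows $1,\dots,k$ from top to bottom, left-justified, cells $(i,j)$ with $1\le j\le\lambda_i$; $T(i,j)$ is the entry in cell $(i,j)$. A diagram is a filling of the cells with 0s and 1s. An X-diagram is a diagram with no rows $i<i'$ and columns $j<j'$ (all four cells in the shape) such that the entries $T(i,j),T(i,j'),T(i',j),T(i',j')$ equal $1,0,0,1$ or $0,1,1,0$. A zero-row is a row of 0s. The pivot column of $T$ is defined as follows: among the columns $j\in\{1,\dots,\lambda_k\}$ with $T(k,j)=1$, consider those having the maximal number of 0s, and take the leftmost of these (it exists iff the bottom row is not a zero-row). -}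

module Defs where

open import Data.Nat using (ℕ; zero; suc; _+_; _≤_; _<_; _∸_; _≤ᵇ_)
open import Data.Bool using (Bool; true; false; not; _∧_; if_then_else_)
open import Data.Product using (_×_; ∃-syntax)
open import Data.Sum using (_⊎_)
open import Relation.Nullary using (¬_)
open import Relation.Binary.PropositionalEquality using (_≡_)

-- Conventions: rows and columns are 1-based natural numbers.
-- A shape with k rows is a function  sh : ℕ → ℕ  (sh i = λ_i for 1 ≤ i ≤ k,
-- values outside 1..k are irrelevant).  A filling is  T : ℕ → ℕ → Bool
-- (true = 1, false = 0); only its values on cells of the shape matter.

YoungShape : ℕ → (ℕ → ℕ) → Set
YoungShape k sh =
  (∀ i → 1 ≤ i → i < k → sh (suc i) ≤ sh i) ×
  (∀ i → 1 ≤ i → i ≤ k → 0 < sh i)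

InShape : ℕ → (ℕ → ℕ) → ℕ → ℕ → Set
InShape k sh i j = (1 ≤ i × i ≤ k) × (1 ≤ j × j ≤ sh i)

XDiagram : ℕ → (ℕ → ℕ) → (ℕ → ℕ → Bool) → Set
XDiagram k sh T =
  ¬ (∃[ i ] ∃[ i' ] ∃[ j ] ∃[ j' ]
      (i < i' × j < j' ×
       InShape k sh i j × InShape k sh i j' ×
       InShape k sh i' j × InShape k sh i' j' ×
       ((T i j ≡ true × T i j' ≡ false × T i' j ≡ false × T i' j' ≡ true) ⊎
        (T i j ≡ false × T i j' ≡ true × T i' j ≡ true × T i' j' ≡ false))))

ZeroRow : ℕ → (ℕ → ℕ) → (ℕ → ℕ → Bool) → ℕ → Set
ZeroRow k sh T r = ∀ j → InShape k sh r j → T r j ≡ false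

zerosInCol : (ℕ → ℕ) → (ℕ → ℕ → Bool) → ℕ → ℕ → ℕ
zerosInCol sh T c zero = 0
zerosInCol sh T c (suc m) =
  zerosInCol sh T c m +
  (if (c ≤ᵇ sh (suc m)) ∧ not (T (suc m) c) then 1 else 0)

IsPivot : ℕ → (ℕ → ℕ) → (ℕ → ℕ → Bool) → ℕ → Set
IsPivot k sh T j =
  (1 ≤ j × j ≤ sh k) × T k j ≡ true ×
  (∀ j' → 1 ≤ j' → j' ≤ sh k → T k j' ≡ true →
     zerosInCol sh T j' k ≤ zerosInCol sh T j k) ×
  (∀ j' → 1 ≤ j' → j' < j → T k j' ≡ true →
     zerosInCol sh T j' k < zerosInCol sh T j k)

module Submission where

-- Let K be the bottom row and j the pivot column, and let i < j.
-- Columns i and j have cells in every row, because the row lengths of a Young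
-- diagram are antitone and j ≤ λ_K.
-- (ii) ⇒ (i): if T(K,i) = 1, the pivot is leftmost among the columns with a 1
--   in row K, so column i has fewer 0s than column j in rows 1..K; both bottom
--   entries are 1, so the same holds in rows 1..K-1.
-- (i) ⇒ (ii): if T(K,i) = 0, then rows r < K with T(r,i) = 1, T(r,j) = 0 would
--   form, together with row K (entries 0, 1), a forbidden X-pattern.  Hence
--   every 0 of column j above row K faces a 0 of column i, so column i has at
--   least as many 0s there as column j.

open import Defs
open import Data.Nat using (ℕ; zero; suc; _+_; _≤_; _<_; _∸_; _≤ᵇ_; s≤s; z≤n)
open import Data.Nat.Properties
  using (≤-refl; ≤-trans; ≤-pred; n≤1+n; <⇒≤; <⇒≱; +-mono-≤; +-identityʳ;
         m≤n⇒m<n∨m≡n; ≤⇒≤ᵇ)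
open import Data.Bool using (Bool; true; false; not; _∧_; if_then_else_)
open import Data.Bool.Properties using (T-≡; ∧-zeroʳ)
open import Data.Product using (_×_; _,_; proj₁)
open import Data.Sum using (inj₁; inj₂)
open import Data.Empty using (⊥-elim)
open import Function.Bundles using (Equivalence)
open import Relation.Nullary using (¬_)
open import Relation.Binary.PropositionalEquality
  using (_≡_; refl; cong; subst₂; module ≡-Reasoning)

-- Cell (r, c) of the shape holds a 0; this is exactly the summand that
-- zerosInCol adds for row r.
zeroCell : (ℕ → ℕ) → (ℕ → ℕ → Bool) → ℕ → ℕ → Bool
zeroCell sh T c r = (c ≤ᵇ sh r) ∧ not (T r c)

≤ᵇ-true : ∀ {m n} → m ≤ n → (m ≤ᵇ n) ≡ true
≤ᵇ-true m≤n = Equivalence.to T-≡ (≤⇒≤ᵇ m≤n)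

zeroCell-intro : ∀ (sh : ℕ → ℕ) (T : ℕ → ℕ → Bool) {c r} →
  c ≤ sh r → T r c ≡ false → zeroCell sh T c r ≡ true
zeroCell-intro sh T c≤λr Trc≡0 rewrite ≤ᵇ-true c≤λr | Trc≡0 = refl

zeroCell-entry : ∀ (sh : ℕ → ℕ) (T : ℕ → ℕ → Bool) c r →
  zeroCell sh T c r ≡ true → T r c ≡ false
zeroCell-entry sh T c r zero-at with T r c | c ≤ᵇ sh r | zero-at
... | false | _     | _  = refl
... | true  | false | ()
... | true  | true  | ()

indicator-mono : ∀ {a b : Bool} → (a ≡ true → b ≡ true) →
  (if a then 1 else 0) ≤ (if b then 1 else 0)
indicator-mono {false}         a⇒b = z≤n
indicator-mono {true}          a⇒b with a⇒b refl
indicator-mono {true} {true}   a⇒b | refl = ≤-refl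

zerosInCol-mono : ∀ (sh : ℕ → ℕ) (T : ℕ → ℕ → Bool) c' c m →
  (∀ r → 1 ≤ r → r ≤ m → zeroCell sh T c' r ≡ true → zeroCell sh T c r ≡ true) →
  zerosInCol sh T c' m ≤ zerosInCol sh T c m
zerosInCol-mono sh T c' c zero    faces = z≤n
zerosInCol-mono sh T c' c (suc m) faces =
  +-mono-≤ (zerosInCol-mono sh T c' c m
              (λ r 1≤r r≤m → faces r 1≤r (≤-trans r≤m (n≤1+n m))))
           (indicator-mono (faces (suc m) (s≤s z≤n) ≤-refl))

zerosInCol-one : ∀ (sh : ℕ → ℕ) (T : ℕ → ℕ → Bool) c m → T (suc m) c ≡ true →
  zerosInCol sh T c (suc m) ≡ zerosInCol sh T c m
zerosInCol-one sh T c m Tmc≡1 = begin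
  zerosInCol sh T c m + (if (c ≤ᵇ sh (suc m)) ∧ not (T (suc m) c) then 1 else 0)
    ≡⟨ cong (λ b → zerosInCol sh T c m + (if (c ≤ᵇ sh (suc m)) ∧ not b then 1 else 0))
            Tmc≡1 ⟩
  zerosInCol sh T c m + (if (c ≤ᵇ sh (suc m)) ∧ false then 1 else 0)
    ≡⟨ cong (λ b → zerosInCol sh T c m + (if b then 1 else 0)) (∧-zeroʳ _) ⟩
  zerosInCol sh T c m + 0
    ≡⟨ +-identityʳ _ ⟩
  zerosInCol sh T c m ∎
  where open ≡-Reasoning

shape-antitone : ∀ {k sh} → YoungShape k sh →
  ∀ {r} s → 1 ≤ r → r ≤ s → s ≤ k → sh s ≤ sh r
shape-antitone Y zero    (s≤s z≤n) ()
shape-antitone Y (suc s) 1≤r r≤1+s 1+s≤k with m≤n⇒m<n∨m≡n r≤1+s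
... | inj₂ refl = ≤-refl
... | inj₁ r<1+s =
  ≤-trans (proj₁ Y s (≤-trans 1≤r r≤s) 1+s≤k)
          (shape-antitone Y s 1≤r r≤s (≤-trans (n≤1+n s) 1+s≤k))
  where r≤s = ≤-pred r<1+s

X-zero-propagates : ∀ {k sh T} → XDiagram k sh T →
  ∀ {r r' c c'} → r < r' → c < c' →
  InShape k sh r c → InShape k sh r c' → InShape k sh r' c → InShape k sh r' c' →
  T r' c ≡ false → T r' c' ≡ true → T r c' ≡ false → T r c ≡ false
X-zero-propagates {T = T} X {r} {c = c} r<r' c<c' rc rc' r'c r'c' T'c T'c' Tc'
  with T r c in Tc
... | false = refl
... | true  = ⊥-elim (X (_ , _ , _ , _ , r<r' , c<c' , rc , rc' , r'c , r'c' ,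
                         inj₁ (Tc , Tc' , T'c , T'c')))

lemma3p5 : (k : ℕ) (sh : ℕ → ℕ) (T : ℕ → ℕ → Bool) →
    1 ≤ k → YoungShape k sh → XDiagram k sh T → ¬ ZeroRow k sh T k →
    (j : ℕ) → IsPivot k sh T j →
    (i : ℕ) → 1 ≤ i → i < j →
    (zerosInCol sh T i (k ∸ 1) < zerosInCol sh T j (k ∸ 1) → T k i ≡ true) ×
    (T k i ≡ true → zerosInCol sh T i (k ∸ 1) < zerosInCol sh T j (k ∸ 1))
-- k = 0 is excluded by 1 ≤ k; write K = k + 1 for the bottom row.
lemma3p5 (suc k) sh T _ Y X _ j ((1≤j , j≤λK) , TKj≡1 , _ , leftmost) i 1≤i i<j =
  fewer-zeros⇒one , one⇒fewer-zeros
  where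
  K = suc k

  j-in-row : ∀ r → 1 ≤ r → r ≤ K → j ≤ sh r
  j-in-row r 1≤r r≤K = ≤-trans j≤λK (shape-antitone Y K 1≤r r≤K ≤-refl)

  cell : ∀ {r c} → 1 ≤ r → r ≤ K → 1 ≤ c → c ≤ j → InShape K sh r c
  cell 1≤r r≤K 1≤c c≤j = (1≤r , r≤K) , 1≤c , ≤-trans c≤j (j-in-row _ 1≤r r≤K)

  zero⇒not-fewer : T K i ≡ false → zerosInCol sh T j k ≤ zerosInCol sh T i k
  zero⇒not-fewer TKi≡0 = zerosInCol-mono sh T j i k faces
    where
    faces : ∀ r → 1 ≤ r → r ≤ k → zeroCell sh T j r ≡ true → zeroCell sh T i r ≡ true
    faces r 1≤r r≤k zero-at-j =
      zeroCell-intro sh T (≤-trans (<⇒≤ i<j) (j-in-row r 1≤r r≤K))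
        (X-zero-propagates X (s≤s r≤k) i<j
           (cell 1≤r r≤K 1≤i (<⇒≤ i<j)) (cell 1≤r r≤K 1≤j ≤-refl)
           (cell (s≤s z≤n) ≤-refl 1≤i (<⇒≤ i<j)) (cell (s≤s z≤n) ≤-refl 1≤j ≤-refl)
           TKi≡0 TKj≡1 (zeroCell-entry sh T j r zero-at-j))
      where r≤K = ≤-trans r≤k (n≤1+n k)

  fewer-zeros⇒one : zerosInCol sh T i k < zerosInCol sh T j k → T K i ≡ true
  fewer-zeros⇒one fewer with T K i in TKi
  ... | true  = refl
  ... | false = ⊥-elim (<⇒≱ fewer (zero⇒not-fewer TKi))

  -- (ii) ⇒ (i): leftmost choice of the pivot, and both bottom entries are 1
  one⇒fewer-zeros : T K i ≡ true → zerosInCol sh T i k < zerosInCol sh T j k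
  one⇒fewer-zeros TKi≡1 =
    subst₂ _<_ (zerosInCol-one sh T i k TKi≡1) (zerosInCol-one sh T j k TKj≡1)
           (leftmost i 1≤i i<j TKi≡1)
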